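{- For each $n\in\{1,2,3\}$, the statement "$A$ is Type $n$" is first-order definable in $\mathcal{E}^*$ (c.e. sets under inclusion modulo finite sets).
   Context: All sets are c.e. subsets of $\omega$. $\mathcal{E}^*$ is the lattice of c.e. sets under inclusion modulo finite sets. $X\subseteq^*Y$ means $X-Y$ is finite. A collection $\mathcal{G}$ of c.e. sets generates $\mathcal{D}(A)$ if every member of $\mathcal{G}$ is disjoint from $A$ and every c.e. set disjoint from $A$ is $\subseteq^*$ the union of finitely many members of $\mathcal{G}$. A generating collection is of Type 1 if it is $\{\emptyset\}$, of Type 2 if it is $\{R\}$ with $R$ infinite computable, of Type 3 if it is $\{W\}$ with $W$ infinite noncomputable. $A$ is Type 1 if $\mathcal{D}(A)$ has a Type 1 generating collection; $A$ is Type 2 if it has one of Type 2 but none of Type 1; $A$ is Type 3 if it has one of Type 3 but none of Type 1 or 2. -}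

module Defs where

open import Data.Nat using (ℕ; zero; suc; _<_)
open import Data.Fin using (Fin)
import Data.Fin as F
open import Data.Vec using (Vec; []; _∷_; lookup)
open import Data.List using (List)
open import Data.List.Relation.Unary.All using (All)
open import Data.List.Relation.Unary.Any using (Any)
open import Data.Product using (Σ; _×_)
open import Data.Empty using (⊥)
open import Relation.Nullary using (¬_)
open import Function.Bundles using (_⇔_)

data Code : ℕ → Set where
  zeroC : ∀ {k} → Code k
  succC : Code 1
  projC : ∀ {k} → Fin k → Code k
  compC : ∀ {k m} → Code m → Vec (Code k) m → Code k
  precC : ∀ {k} → Code k → Code (suc (suc k)) → Code (suc k)
  muC   : ∀ {k} → Code (suc k) → Code k

mutual
  data Eval : ∀ {k} → Code k → Vec ℕ k → ℕ → Set where
    ev-zero : ∀ {k} {xs : Vec ℕ k} → Eval zeroC xs 0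
    ev-succ : ∀ {x} → Eval succC (x ∷ []) (suc x)
    ev-proj : ∀ {k} {i : Fin k} {xs} → Eval (projC i) xs (lookup xs i)
    ev-comp : ∀ {k m} {f : Code m} {gs : Vec (Code k) m} {xs ys y}
            → EvalVec gs xs ys → Eval f ys y → Eval (compC f gs) xs y
    ev-prec0 : ∀ {k} {g : Code k} {h} {xs y}
             → Eval g xs y → Eval (precC g h) (0 ∷ xs) y
    ev-precS : ∀ {k} {g : Code k} {h} {n xs z y}
             → Eval (precC g h) (n ∷ xs) z → Eval h (n ∷ z ∷ xs) y
             → Eval (precC g h) (suc n ∷ xs) y
    ev-mu : ∀ {k} {f : Code (suc k)} {xs n}
          → Search f xs 0 n → Eval (muC f) xs n

  data EvalVec {k : ℕ} : ∀ {m} → Vec (Code k) m → Vec ℕ k → Vec ℕ m → Set where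
    []  : ∀ {xs} → EvalVec [] xs []
    _∷_ : ∀ {m g y} {gs : Vec (Code k) m} {xs ys}
        → Eval g xs y → EvalVec gs xs ys → EvalVec (g ∷ gs) xs (y ∷ ys)

  data Search {k : ℕ} (f : Code (suc k)) (xs : Vec ℕ k) : ℕ → ℕ → Set where
    here  : ∀ {i} → Eval f (i ∷ xs) 0 → Search f xs i i
    there : ∀ {i y n} → Eval f (i ∷ xs) (suc y) → Search f xs (suc i) n
          → Search f xs i n

-- C.e. sets: W_e = domain of the unary partial recursive function e

CE : Set
CE = Code 1

_∈W_ : ℕ → CE → Set
x ∈W e = Σ ℕ (Eval e (x ∷ []))

Pred : Set₁
Pred = ℕ → Set

Finite : Pred → Set
Finite X = Σ ℕ λ b → ∀ x → X x → x < b

Infinite : CE → Set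
Infinite W = ¬ Finite (λ x → x ∈W W)

_⊆*_ : Pred → Pred → Set
X ⊆* Y = Finite (λ x → X x × ¬ Y x)

_=*_ : Pred → Pred → Set
X =* Y = (X ⊆* Y) × (Y ⊆* X)

⟦_⟧ : CE → Pred
⟦ W ⟧ x = x ∈W W

Computable : CE → Set
Computable W = Σ CE λ V → ∀ x → (x ∈W V) ⇔ (¬ x ∈W W)

Disjoint : CE → CE → Set
Disjoint V W = ∀ x → x ∈W V → x ∈W W → ⊥

SameSet : CE → CE → Set
SameSet V W = ∀ x → (x ∈W V) ⇔ (x ∈W W)

IsEmpty : CE → Set
IsEmpty V = ∀ x → ¬ x ∈W V

Collection : Set₁
Collection = CE → Set

Union : List CE → Pred
Union Ws x = Any (λ W → x ∈W W) Ws

Generates : Collection → CE → Set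
Generates G A =
  (∀ W → G W → Disjoint W A) ×
  (∀ V → Disjoint V A → Σ (List CE) λ Ws → All G Ws × (⟦ V ⟧ ⊆* Union Ws))

-- the collection {W} (membership is extensional equality of sets)
Singleton : CE → Collection
Singleton W V = SameSet V W

SingletonEmpty : Collection
SingletonEmpty V = IsEmpty V

HasType1Gen HasType2Gen HasType3Gen : CE → Set
HasType1Gen A = Generates SingletonEmpty A
HasType2Gen A = Σ CE λ R → Infinite R × Computable R × Generates (Singleton R) A
HasType3Gen A = Σ CE λ W → Infinite W × ¬ Computable W × Generates (Singleton W) A

IsType : ℕ → CE → Set
IsType 1 A = HasType1Gen A
IsType 2 A = HasType2Gen A × ¬ HasType1Gen A
IsType 3 A = HasType3Gen A × ¬ HasType1Gen A × ¬ HasType2Gen A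
IsType _ A = ⊥

data Formula : ℕ → Set where
  _≤'_ : ∀ {n} → Fin n → Fin n → Formula n
  _≐_  : ∀ {n} → Fin n → Fin n → Formula n
  ⊥'   : ∀ {n} → Formula n
  _⇒_  : ∀ {n} → Formula n → Formula n → Formula n
  ∀'   : ∀ {n} → Formula (suc n) → Formula n

Env : ℕ → Set
Env n = Fin n → CE

extend : ∀ {n} → CE → Env n → Env (suc n)
extend W ρ F.zero = W
extend W ρ (F.suc i) = ρ i

-- satisfaction in 𝓔*: elements of 𝓔* are represented by c.e. indices,
-- ≤ is ⊆*, equality is =*
Sat : ∀ {n} → Formula n → Env n → Set
Sat (i ≤' j) ρ = ⟦ ρ i ⟧ ⊆* ⟦ ρ j ⟧
Sat (i ≐ j) ρ = ⟦ ρ i ⟧ =* ⟦ ρ j ⟧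
Sat ⊥' ρ = ⊥
Sat (φ ⇒ ψ) ρ = Sat φ ρ → Sat ψ ρ
Sat (∀' φ) ρ = (W : CE) → Sat φ (extend W ρ)

Definable : (CE → Set) → Set
Definable P = Σ (Formula 1) λ φ → ∀ A → Sat φ (λ _ → A) ⇔ P A

-- With excluded middle, all three types are properties of A expressible in 𝓔* once "finite" and
-- "disjoint" are read modulo finite sets.  A is of Type 1 iff every set almost disjoint from A is
-- finite, and {R} generates 𝒟(A) for some R iff some R almost disjoint from A almost contains every
-- set almost disjoint from A (cutting off an initial segment of R makes it exactly disjoint).
-- Computability of R is definable as having a complement in 𝓔*, and being infinite as not being
-- the least element.  To evaluate meets and joins in 𝓔* one needs c.e. intersections and unions;
-- unions are obtained by dovetailing through a primitive recursive clocked interpreter.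
module Submission where

open import Defs
open import Level using (0ℓ)
open import Axiom.ExcludedMiddle using (ExcludedMiddle)
open import Data.Nat using (ℕ; zero; suc; _+_; _*_; _∸_; pred; _≤_; _<_; z≤n; s≤s; z<s; _<?_)
open import Data.Nat.Properties
  using ( +-identityʳ; +-suc; *-identityˡ; *-zeroʳ; m*n≡0⇒m≡0∨n≡0; pred[m∸n]≡m∸[1+n]
        ; m∸n≡0⇒m≤n; m≤n⇒m∸n≡0; m<n+m; m≤m+n; m≤n+m; m+n≤o⇒m≤o; m+n≤o⇒n≤o
        ; m<1+n⇒m<n∨m≡n; m≤n⇒m<n∨m≡n; <⇒≤; ≤-refl; ≤-antisym; <-≤-trans; ≰⇒>; <⇒≱; ≮⇒≥; n≮0 )
open import Data.Fin as F using (Fin; #_; _↑ʳ_)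
open import Data.Vec using (Vec; []; _∷_; _++_; lookup; map; tabulate)
open import Data.Vec.Properties using (lookup-++ʳ; map-∘; map-id)
open import Data.List using ([]; _∷_)
open import Data.List.Relation.Unary.All using (All; []; _∷_)
open import Data.List.Relation.Unary.Any using (here; there)
open import Data.Product using (Σ; _×_; _,_; proj₁; proj₂)
open import Data.Sum using (_⊎_; inj₁; inj₂; [_,_])
open import Data.Empty using (⊥-elim)
open import Function using (_∘_)
open import Function.Bundles using (_⇔_; mk⇔; Equivalence)
open import Relation.Nullary using (¬_; yes; no)
open import Relation.Nullary.Decidable using (decidable-stable; ¬¬-excluded-middle)
open import Relation.Nullary.Negation using (¬¬-map)
open import Relation.Unary using (_∩_; _∪_; ∁; _⊆_)
open import Function.Related.TypeIsomorphisms using (¬-cong-⇔; →-cong-⇔)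
open import Function.Construct.Composition using (_⇔-∘_)
open import Function.Construct.Identity using (⇔-id)
open import Function.Construct.Symmetry using (⇔-sym)
open import Relation.Binary.PropositionalEquality
  using (_≡_; refl; sym; trans; cong; cong₂; subst; module ≡-Reasoning)

open Equivalence using (to; from)

mutual
  eval-deterministic : ∀ {k} {c : Code k} {xs y y′} → Eval c xs y → Eval c xs y′ → y ≡ y′
  eval-deterministic ev-zero ev-zero = refl
  eval-deterministic ev-succ ev-succ = refl
  eval-deterministic ev-proj ev-proj = refl
  eval-deterministic (ev-comp as e) (ev-comp as′ e′) with evalVec-deterministic as as′
  ... | refl = eval-deterministic e e′
  eval-deterministic (ev-prec0 e) (ev-prec0 e′) = eval-deterministic e e′
  eval-deterministic (ev-precS p e) (ev-precS p′ e′) with eval-deterministic p p′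
  ... | refl = eval-deterministic e e′
  eval-deterministic (ev-mu s) (ev-mu s′) = search-deterministic s s′

  evalVec-deterministic : ∀ {k m} {gs : Vec (Code k) m} {xs ys ys′} →
                          EvalVec gs xs ys → EvalVec gs xs ys′ → ys ≡ ys′
  evalVec-deterministic [] [] = refl
  evalVec-deterministic (e ∷ es) (e′ ∷ es′) =
    cong₂ _∷_ (eval-deterministic e e′) (evalVec-deterministic es es′)

  search-deterministic : ∀ {k} {f : Code (suc k)} {xs i n n′} →
                         Search f xs i n → Search f xs i n′ → n ≡ n′
  search-deterministic (here e) (here e′) = refl
  search-deterministic (here e) (there e′ s′) with eval-deterministic e e′
  ... | ()
  search-deterministic (there e s) (here e′) with eval-deterministic e e′
  ... | ()
  search-deterministic (there e s) (there e′ s′) = search-deterministic s s′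

search-hit : ∀ {k} {f : Code (suc k)} {xs i n} → Search f xs i n → Eval f (n ∷ xs) 0
search-hit (here e) = e
search-hit (there e s) = search-hit s

leastZero⇒search : ∀ {k} {f : Code (suc k)} {xs y} →
                   (∀ j → j < y → Σ ℕ λ z → Eval f (j ∷ xs) (suc z)) → Eval f (y ∷ xs) 0 →
                   Search f xs 0 y
leastZero⇒search {f = f} {xs} {y} nonzero hit = go y 0 (+-identityʳ y)
  where
  go : ∀ d i → d + i ≡ y → Search f xs i y
  go zero i refl = here hit
  go (suc d) i e =
    there (proj₂ (nonzero i (subst (i <_) e (m<n+m i z<s)))) (go d (suc i) (trans (+-suc d i) e))

totalZero⇒search : ∀ {k} {c : Code (suc k)} {xs} {v : ℕ → ℕ} →
                   (∀ t → Eval c (t ∷ xs) (v t)) → ∀ t₀ → v t₀ ≡ 0 → Σ ℕ (Search c xs 0)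
totalZero⇒search {c = c} {xs} {v} c-eval t₀ v≡0 = go t₀ 0 (+-identityʳ t₀)
  where
  go : ∀ d i → d + i ≡ t₀ → Σ ℕ (Search c xs i)
  go d i e with v i in eq
  ... | zero = i , here (subst (Eval c (i ∷ xs)) eq (c-eval i))
  go zero i refl | suc _ with trans (sym eq) v≡0
  ... | ()
  go (suc d) i e | suc _ =
    let n , s = go d (suc i) (trans (+-suc d i) e) in n , there (subst (Eval c (i ∷ xs)) eq (c-eval i)) s

oneC : ∀ {k} → Code k
oneC = compC succC (zeroC ∷ [])

oneC-eval : ∀ {k} {xs : Vec ℕ k} → Eval oneC xs 1
oneC-eval = ev-comp (ev-zero ∷ []) ev-succ

addC : Code 2
addC = precC (projC (# 0)) (compC succC (projC (# 1) ∷ []))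

addC-eval : ∀ m n → Eval addC (m ∷ n ∷ []) (m + n)
addC-eval zero n = ev-prec0 ev-proj
addC-eval (suc m) n = ev-precS (addC-eval m n) (ev-comp (ev-proj ∷ []) ev-succ)

mulC : Code 2
mulC = precC zeroC (compC addC (projC (# 2) ∷ projC (# 1) ∷ []))

mulC-eval : ∀ m n → Eval mulC (m ∷ n ∷ []) (m * n)
mulC-eval zero n = ev-prec0 ev-zero
mulC-eval (suc m) n = ev-precS (mulC-eval m n) (ev-comp (ev-proj ∷ ev-proj ∷ []) (addC-eval n (m * n)))

predC : Code 1
predC = precC zeroC (projC (# 0))

predC-eval : ∀ n → Eval predC (n ∷ []) (pred n)
predC-eval zero = ev-prec0 ev-zero
predC-eval (suc n) = ev-precS (predC-eval n) ev-proj

sg sgᶜ : ℕ → ℕ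
sg zero = 0
sg (suc _) = 1
sgᶜ zero = 1
sgᶜ (suc _) = 0

sgC : Code 1
sgC = precC zeroC oneC

sgC-eval : ∀ n → Eval sgC (n ∷ []) (sg n)
sgC-eval zero = ev-prec0 ev-zero
sgC-eval (suc n) = ev-precS (sgC-eval n) oneC-eval

sgᶜC : Code 1
sgᶜC = precC oneC zeroC

sgᶜC-eval : ∀ n → Eval sgᶜC (n ∷ []) (sgᶜ n)
sgᶜC-eval zero = ev-prec0 oneC-eval
sgᶜC-eval (suc n) = ev-precS (sgᶜC-eval n) ev-zero

constC : ∀ {k} → ℕ → Code k
constC zero = zeroC
constC (suc n) = compC succC (constC n ∷ [])

constC-eval : ∀ {k} n {xs : Vec ℕ k} → Eval (constC n) xs n
constC-eval zero = ev-zero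
constC-eval (suc n) = ev-comp (constC-eval n ∷ []) ev-succ

monusC : Code 2
monusC = precC (projC (# 0)) (compC predC (projC (# 1) ∷ []))

monusC-eval : ∀ m n → Eval monusC (n ∷ m ∷ []) (m ∸ n)
monusC-eval m zero = ev-prec0 ev-proj
monusC-eval m (suc n) =
  subst (Eval monusC (suc n ∷ m ∷ [])) (pred[m∸n]≡m∸[1+n] m n)
        (ev-precS (monusC-eval m n) (ev-comp (ev-proj ∷ []) (predC-eval _)))

projections : ∀ {k n} → (Fin k → Fin n) → Vec (Code n) k
projections ι = tabulate (projC ∘ ι)

projections-eval : ∀ {k n} (ι : Fin k → Fin n) (ys : Vec ℕ n) (xs : Vec ℕ k) →
                   (∀ i → lookup ys (ι i) ≡ lookup xs i) → EvalVec (projections ι) ys xs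
projections-eval ι ys [] _ = []
projections-eval ι ys (x ∷ xs) p =
  subst (Eval (projC (ι F.zero)) ys) (p F.zero) ev-proj ∷ projections-eval (ι ∘ F.suc) ys xs (p ∘ F.suc)

dropC : ∀ m {k} → Vec (Code (m + k)) k
dropC m = projections (m ↑ʳ_)

dropC-eval : ∀ {m k} (ys : Vec ℕ m) (xs : Vec ℕ k) → EvalVec (dropC m) (ys ++ xs) xs
dropC-eval ys xs = projections-eval _ (ys ++ xs) xs (lookup-++ʳ ys xs)

suc²C : Code 1
suc²C = compC succC (succC ∷ [])

suc²C-eval : ∀ n → Eval suc²C (n ∷ []) (suc (suc n))
suc²C-eval n = ev-comp (ev-succ ∷ []) ev-succ

-- States of a clocked μ-search: 0 = stuck, 1 = still searching, suc (suc n) = found n.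
-- probe v j is the next state when the searched function has clocked value v at j.
probe : ℕ → ℕ → ℕ
probe zero j = 0
probe (suc zero) j = suc (suc j)
probe (suc (suc _)) j = 1

searchStep : ℕ → ℕ → ℕ → ℕ
searchStep zero j v = 0
searchStep (suc zero) j v = probe v j
searchStep (suc (suc n)) j v = suc (suc n)

probeC : Code 2
probeC = precC zeroC (compC (precC suc²C oneC) (projC (# 0) ∷ projC (# 2) ∷ []))

probeC-eval : ∀ v j → Eval probeC (v ∷ j ∷ []) (probe v j)
probeC-eval zero j = ev-prec0 ev-zero
probeC-eval (suc v) j = ev-precS (probeC-eval v j) (ev-comp (ev-proj ∷ ev-proj ∷ []) (probeSuc v))
  where
  probeSuc : ∀ n → Eval (precC suc²C oneC) (n ∷ j ∷ []) (probe (suc n) j)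
  probeSuc zero = ev-prec0 (suc²C-eval j)
  probeSuc (suc n) = ev-precS (probeSuc n) oneC-eval

searchStepC : Code 3
searchStepC = precC zeroC (compC searchingC (projC (# 0) ∷ projC (# 2) ∷ projC (# 3) ∷ []))
  where
  searchingC : Code 3
  searchingC = precC (compC probeC (projC (# 1) ∷ projC (# 0) ∷ [])) (compC suc²C (projC (# 0) ∷ []))

searchStepC-eval : ∀ s j v → Eval searchStepC (s ∷ j ∷ v ∷ []) (searchStep s j v)
searchStepC-eval zero j v = ev-prec0 ev-zero
searchStepC-eval (suc s) j v =
  ev-precS (searchStepC-eval s j v) (ev-comp (ev-proj ∷ ev-proj ∷ ev-proj ∷ []) (searching s))
  where
  searching : ∀ n → Eval _ (n ∷ j ∷ v ∷ []) (searchStep (suc n) j v)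
  searching zero = ev-prec0 (ev-comp (ev-proj ∷ ev-proj ∷ []) (probeC-eval v j))
  searching (suc n) = ev-precS (searching n) (ev-comp (ev-proj ∷ []) (suc²C-eval n))

allPositive : ∀ {m} → Vec ℕ m → ℕ
allPositive [] = 1
allPositive (v ∷ vs) = sg v * allPositive vs

-- clocked c t xs is 0 while the computation of c on xs has not halted
-- within clock t, and suc y once it halted with output y; the clock bounds
-- the length of every μ-search.
mutual
  clocked : ∀ {k} → Code k → ℕ → Vec ℕ k → ℕ
  clocked zeroC t xs = 1
  clocked succC t (x ∷ []) = suc (suc x)
  clocked (projC i) t xs = suc (lookup xs i)
  clocked (compC f gs) t xs =
    allPositive (clockedVec gs t xs) * clocked f t (map pred (clockedVec gs t xs))
  clocked (precC g h) t (n ∷ xs) = clockedRec g h t n xs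
  clocked (muC f) t xs = pred (clockedSearch f t xs t)

  clockedVec : ∀ {k m} → Vec (Code k) m → ℕ → Vec ℕ k → Vec ℕ m
  clockedVec [] t xs = []
  clockedVec (g ∷ gs) t xs = clocked g t xs ∷ clockedVec gs t xs

  clockedRec : ∀ {k} → Code k → Code (suc (suc k)) → ℕ → ℕ → Vec ℕ k → ℕ
  clockedRec g h t zero xs = clocked g t xs
  clockedRec g h t (suc n) xs =
    sg (clockedRec g h t n xs) * clocked h t (n ∷ pred (clockedRec g h t n xs) ∷ xs)

  clockedSearch : ∀ {k} → Code (suc k) → ℕ → Vec ℕ k → ℕ → ℕ
  clockedSearch f t xs zero = 1
  clockedSearch f t xs (suc j) = searchStep (clockedSearch f t xs j) j (clocked f t (j ∷ xs))

allPositiveC : ∀ {n m} → Vec (Code n) m → Code n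
allPositiveC [] = oneC
allPositiveC (c ∷ cs) = compC mulC (compC sgC (c ∷ []) ∷ allPositiveC cs ∷ [])

allPositiveC-eval : ∀ {n m} {cs : Vec (Code n) m} {xs vs} →
                    EvalVec cs xs vs → Eval (allPositiveC cs) xs (allPositive vs)
allPositiveC-eval [] = oneC-eval
allPositiveC-eval (e ∷ es) =
  ev-comp (ev-comp (e ∷ []) (sgC-eval _) ∷ allPositiveC-eval es ∷ []) (mulC-eval _ _)

predVecC : ∀ {n m} → Vec (Code n) m → Vec (Code n) m
predVecC [] = []
predVecC (c ∷ cs) = compC predC (c ∷ []) ∷ predVecC cs

predVecC-eval : ∀ {n m} {cs : Vec (Code n) m} {xs vs} →
                EvalVec cs xs vs → EvalVec (predVecC cs) xs (map pred vs)
predVecC-eval [] = []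
predVecC-eval (e ∷ es) = ev-comp (e ∷ []) (predC-eval _) ∷ predVecC-eval es

mutual
  clockedC : ∀ {k} → Code k → Code (suc k)
  clockedC zeroC = oneC
  clockedC succC = compC suc²C (projC (# 1) ∷ [])
  clockedC (projC i) = compC succC (projC (F.suc i) ∷ [])
  clockedC (compC f gs) =
    compC mulC (allPositiveC (clockedVecC gs) ∷
                compC (clockedC f) (projC (# 0) ∷ predVecC (clockedVecC gs)) ∷ [])
  clockedC (precC g h) = compC (clockedRecC g h) (projC (# 1) ∷ projC (# 0) ∷ dropC 2)
  clockedC (muC f) = compC predC (compC (clockedSearchC f) (projC (# 0) ∷ projC (# 0) ∷ dropC 1) ∷ [])

  clockedVecC : ∀ {k m} → Vec (Code k) m → Vec (Code (suc k)) m
  clockedVecC [] = []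
  clockedVecC (g ∷ gs) = clockedC g ∷ clockedVecC gs

  clockedRecC : ∀ {k} → Code k → Code (suc (suc k)) → Code (suc (suc k))
  clockedRecC g h = precC (clockedC g)
    (compC mulC (compC sgC (projC (# 1) ∷ []) ∷
                 compC (clockedC h)
                       (projC (# 2) ∷ projC (# 0) ∷ compC predC (projC (# 1) ∷ []) ∷ dropC 3) ∷ []))

  clockedSearchC : ∀ {k} → Code (suc k) → Code (suc (suc k))
  clockedSearchC f = precC oneC
    (compC searchStepC (projC (# 1) ∷ projC (# 0) ∷
                        compC (clockedC f) (projC (# 2) ∷ projC (# 0) ∷ dropC 3) ∷ []))

mutual
  clockedC-eval : ∀ {k} (c : Code k) t xs → Eval (clockedC c) (t ∷ xs) (clocked c t xs)
  clockedC-eval zeroC t xs = oneC-eval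
  clockedC-eval succC t (x ∷ []) = ev-comp (ev-proj ∷ []) (suc²C-eval x)
  clockedC-eval (projC i) t xs = ev-comp (ev-proj ∷ []) ev-succ
  clockedC-eval (compC f gs) t xs =
    ev-comp (allPositiveC-eval (clockedVecC-eval gs t xs) ∷
             ev-comp (ev-proj ∷ predVecC-eval (clockedVecC-eval gs t xs)) (clockedC-eval f t _) ∷ [])
            (mulC-eval _ _)
  clockedC-eval (precC g h) t (n ∷ xs) =
    ev-comp (ev-proj ∷ ev-proj ∷ dropC-eval (t ∷ n ∷ []) xs) (clockedRecC-eval g h t n xs)
  clockedC-eval (muC f) t xs =
    ev-comp (ev-comp (ev-proj ∷ ev-proj ∷ dropC-eval (t ∷ []) xs) (clockedSearchC-eval f t xs t) ∷ [])
            (predC-eval _)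

  clockedVecC-eval : ∀ {k m} (gs : Vec (Code k) m) t xs →
                     EvalVec (clockedVecC gs) (t ∷ xs) (clockedVec gs t xs)
  clockedVecC-eval [] t xs = []
  clockedVecC-eval (g ∷ gs) t xs = clockedC-eval g t xs ∷ clockedVecC-eval gs t xs

  clockedRecC-eval : ∀ {k} (g : Code k) h t n xs →
                     Eval (clockedRecC g h) (n ∷ t ∷ xs) (clockedRec g h t n xs)
  clockedRecC-eval g h t zero xs = ev-prec0 (clockedC-eval g t xs)
  clockedRecC-eval g h t (suc n) xs = ev-precS (clockedRecC-eval g h t n xs)
    (ev-comp (ev-comp (ev-proj ∷ []) (sgC-eval _) ∷
              ev-comp (ev-proj ∷ ev-proj ∷ ev-comp (ev-proj ∷ []) (predC-eval _) ∷
                       dropC-eval (n ∷ _ ∷ t ∷ []) xs)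
                      (clockedC-eval h t _) ∷ [])
             (mulC-eval _ _))

  clockedSearchC-eval : ∀ {k} (f : Code (suc k)) t xs j →
                        Eval (clockedSearchC f) (j ∷ t ∷ xs) (clockedSearch f t xs j)
  clockedSearchC-eval f t xs zero = ev-prec0 oneC-eval
  clockedSearchC-eval f t xs (suc j) = ev-precS (clockedSearchC-eval f t xs j)
    (ev-comp (ev-proj ∷ ev-proj ∷
              ev-comp (ev-proj ∷ ev-proj ∷ dropC-eval (j ∷ _ ∷ t ∷ []) xs) (clockedC-eval f t (j ∷ xs)) ∷ [])
             (searchStepC-eval _ _ _))

Bit : ℕ → Set
Bit a = a ≡ 0 ⊎ a ≡ 1

bit*≡suc : ∀ {a b y} → Bit a → a * b ≡ suc y → a ≡ 1 × b ≡ suc y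
bit*≡suc (inj₁ refl) ()
bit*≡suc (inj₂ refl) e = refl , trans (sym (+-identityʳ _)) e

sg-bit : ∀ a → Bit (sg a)
sg-bit zero = inj₁ refl
sg-bit (suc a) = inj₂ refl

allPositive-bit : ∀ {m} (vs : Vec ℕ m) → Bit (allPositive vs)
allPositive-bit [] = inj₂ refl
allPositive-bit (zero ∷ vs) = inj₁ refl
allPositive-bit (suc _ ∷ vs) = subst Bit (sym (*-identityˡ (allPositive vs))) (allPositive-bit vs)

sg≡1 : ∀ {p} → sg p ≡ 1 → p ≡ suc (pred p)
sg≡1 {suc p} _ = refl

pred≡suc : ∀ {s y} → pred s ≡ suc y → s ≡ suc (suc y)
pred≡suc {suc s} e = cong suc e

searchStep≡1 : ∀ s j v → searchStep s j v ≡ 1 → s ≡ 1 × Σ ℕ (λ z → v ≡ suc (suc z))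
searchStep≡1 (suc zero) j (suc (suc v)) e = refl , v , refl

searchStep≡found : ∀ s j v y → searchStep s j v ≡ suc (suc y) →
                   s ≡ suc (suc y) ⊎ (s ≡ 1 × v ≡ 1 × y ≡ j)
searchStep≡found (suc zero) j (suc zero) y refl = inj₂ (refl , refl , refl)
searchStep≡found (suc (suc s)) j v y e = inj₁ e

NonzeroBetween : ∀ {k} → Code (suc k) → ℕ → Vec ℕ k → ℕ → ℕ → Set
NonzeroBetween f t xs i n = ∀ j → i ≤ j → j < n → Σ ℕ λ z → clocked f t (j ∷ xs) ≡ suc (suc z)

NonzeroBelow : ∀ {k} → Code (suc k) → ℕ → Vec ℕ k → ℕ → Set
NonzeroBelow f t xs n = ∀ j → j < n → Σ ℕ λ z → clocked f t (j ∷ xs) ≡ suc (suc z)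

clockedSearch-searching : ∀ {k} (f : Code (suc k)) t xs n →
                          clockedSearch f t xs n ≡ 1 → NonzeroBelow f t xs n
clockedSearch-searching f t xs (suc n) e j j<1+n
  with searchStep≡1 (clockedSearch f t xs n) n (clocked f t (n ∷ xs)) e | m<1+n⇒m<n∨m≡n j<1+n
... | searching , _ | inj₁ j<n = clockedSearch-searching f t xs n searching j j<n
... | _ , nonzero | inj₂ refl = nonzero

clockedSearch-found : ∀ {k} (f : Code (suc k)) t xs n y → clockedSearch f t xs n ≡ suc (suc y) →
                      clocked f t (y ∷ xs) ≡ 1 × NonzeroBelow f t xs y
clockedSearch-found f t xs (suc n) y e
  with searchStep≡found (clockedSearch f t xs n) n (clocked f t (n ∷ xs)) y e
... | inj₁ found = clockedSearch-found f t xs n y found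
... | inj₂ (searching , hit , refl) = hit , clockedSearch-searching f t xs y searching

mutual
  clocked-sound : ∀ {k} (c : Code k) t xs y → clocked c t xs ≡ suc y → Eval c xs y
  clocked-sound zeroC t xs .0 refl = ev-zero
  clocked-sound succC t (x ∷ []) .(suc x) refl = ev-succ
  clocked-sound (projC i) t xs .(lookup xs i) refl = ev-proj
  clocked-sound (compC f gs) t xs y e with bit*≡suc (allPositive-bit (clockedVec gs t xs)) e
  ... | args , result = ev-comp (clockedVec-sound gs t xs args) (clocked-sound f t _ y result)
  clocked-sound (precC g h) t (n ∷ xs) y e = clockedRec-sound g h t n xs y e
  clocked-sound (muC f) t xs y e with clockedSearch-found f t xs t y (pred≡suc e)
  ... | hit , nonzero =
    ev-mu (leastZero⇒search (λ j j<y → let z , ez = nonzero j j<y in z , clocked-sound f t (j ∷ xs) (suc z) ez)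
                            (clocked-sound f t (y ∷ xs) 0 hit))

  clockedVec-sound : ∀ {k m} (gs : Vec (Code k) m) t xs → allPositive (clockedVec gs t xs) ≡ 1 →
                     EvalVec gs xs (map pred (clockedVec gs t xs))
  clockedVec-sound [] t xs e = []
  clockedVec-sound (g ∷ gs) t xs e with bit*≡suc (sg-bit (clocked g t xs)) e
  ... | arg , args = clocked-sound g t xs _ (sg≡1 arg) ∷ clockedVec-sound gs t xs args

  clockedRec-sound : ∀ {k} (g : Code k) h t n xs y →
                     clockedRec g h t n xs ≡ suc y → Eval (precC g h) (n ∷ xs) y
  clockedRec-sound g h t zero xs y e = ev-prec0 (clocked-sound g t xs y e)
  clockedRec-sound g h t (suc n) xs y e with bit*≡suc (sg-bit (clockedRec g h t n xs)) e
  ... | previous , result =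
    ev-precS (clockedRec-sound g h t n xs _ (sg≡1 previous)) (clocked-sound h t _ y result)

Eventually : (ℕ → Set) → Set
Eventually P = Σ ℕ λ t₀ → ∀ t → t₀ ≤ t → P t

eventually-map : ∀ {P Q : ℕ → Set} → (∀ {t} → P t → Q t) → Eventually P → Eventually Q
eventually-map f (t₀ , p) = t₀ , λ t t₀≤t → f (p t t₀≤t)

eventually-both : ∀ {P Q : ℕ → Set} → Eventually P → Eventually Q → Eventually (λ t → P t × Q t)
eventually-both (t₁ , p) (t₂ , q) =
  t₁ + t₂ , λ t t₁+t₂≤t → p t (m+n≤o⇒m≤o t₁ t₁+t₂≤t) , q t (m+n≤o⇒n≤o t₁ t₁+t₂≤t)

eventually-above : ∀ n → Eventually (n <_)
eventually-above n = suc n , λ _ n<t → n<t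

allPositive-suc : ∀ {m} (ys : Vec ℕ m) → allPositive (map suc ys) ≡ 1
allPositive-suc [] = refl
allPositive-suc (y ∷ ys) = trans (+-identityʳ _) (allPositive-suc ys)

clockedSearch-before : ∀ {k} {f : Code (suc k)} {t xs n} →
                       NonzeroBelow f t xs n → ∀ m → m ≤ n → clockedSearch f t xs m ≡ 1
clockedSearch-before nonzero zero _ = refl
clockedSearch-before nonzero (suc m) m<n =
  cong₂ (λ s v → searchStep s m v) (clockedSearch-before nonzero m (<⇒≤ m<n)) (proj₂ (nonzero m m<n))

clockedSearch-after : ∀ {k} {f : Code (suc k)} {t xs n} →
                      NonzeroBelow f t xs n → clocked f t (n ∷ xs) ≡ 1 →
                      ∀ m → n < m → clockedSearch f t xs m ≡ suc (suc n)
clockedSearch-after {f = f} {t} {xs} {n} nonzero hit (suc m) n<1+m with m<1+n⇒m<n∨m≡n n<1+m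
... | inj₁ n<m =
  cong (λ s → searchStep s m (clocked f t (m ∷ xs))) (clockedSearch-after nonzero hit m n<m)
... | inj₂ refl = cong₂ (λ s v → searchStep s n v) (clockedSearch-before nonzero n ≤-refl) hit

mutual
  clocked-complete : ∀ {k} {c : Code k} {xs y} →
                     Eval c xs y → Eventually (λ t → clocked c t xs ≡ suc y)
  clocked-complete ev-zero = 0 , λ _ _ → refl
  clocked-complete ev-succ = 0 , λ _ _ → refl
  clocked-complete ev-proj = 0 , λ _ _ → refl
  clocked-complete {c = compC f gs} {xs} {y} (ev-comp {ys = ys} as e) =
    eventually-map halts (eventually-both (clockedVec-complete as) (clocked-complete e))
    where
    open ≡-Reasoning
    halts : ∀ {t} → clockedVec gs t xs ≡ map suc ys × clocked f t ys ≡ suc y →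
            clocked (compC f gs) t xs ≡ suc y
    halts {t} (args , result) = begin
      allPositive (clockedVec gs t xs) * clocked f t (map pred (clockedVec gs t xs))
        ≡⟨ cong (λ vs → allPositive vs * clocked f t (map pred vs)) args ⟩
      allPositive (map suc ys) * clocked f t (map pred (map suc ys))
        ≡⟨ cong₂ _*_ (allPositive-suc ys)
                     (cong (clocked f t) (trans (sym (map-∘ pred suc ys)) (map-id ys))) ⟩
      1 * clocked f t ys
        ≡⟨ *-identityˡ _ ⟩
      clocked f t ys
        ≡⟨ result ⟩
      suc y ∎
  clocked-complete (ev-prec0 e) = clocked-complete e
  clocked-complete {c = precC g h} {suc n ∷ xs} (ev-precS p e) =
    eventually-map (λ (previous , result) → trans (cong (λ q → sg q * clocked h _ (n ∷ pred q ∷ xs)) previous)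
                                                  (trans (*-identityˡ _) result))
                   (eventually-both (clocked-complete p) (clocked-complete e))
  clocked-complete {c = muC f} {xs} {n} (ev-mu s) =
    eventually-map (λ { {t} ((nonzero , hit) , n<t) →
                        cong pred (clockedSearch-after (λ j → nonzero j z≤n) hit t n<t) })
                   (eventually-both (search-complete s) (eventually-above n))

  clockedVec-complete : ∀ {k m} {gs : Vec (Code k) m} {xs ys} → EvalVec gs xs ys →
                        Eventually (λ t → clockedVec gs t xs ≡ map suc ys)
  clockedVec-complete [] = 0 , λ _ _ → refl
  clockedVec-complete (e ∷ es) =
    eventually-map (λ (p , ps) → cong₂ _∷_ p ps) (eventually-both (clocked-complete e) (clockedVec-complete es))

  search-complete : ∀ {k} {f : Code (suc k)} {xs i n} → Search f xs i n →
                    Eventually (λ t → NonzeroBetween f t xs i n × clocked f t (n ∷ xs) ≡ 1)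
  search-complete (here e) =
    eventually-map (λ hit → (λ j i≤j j<i → ⊥-elim (<⇒≱ j<i i≤j)) , hit) (clocked-complete e)
  search-complete {f = f} {xs} {i} {n} (there e s) =
    eventually-map (λ (probe-i , nonzero , hit) → include-i probe-i nonzero , hit)
                   (eventually-both (clocked-complete e) (search-complete s))
    where
    include-i : ∀ {t y} → clocked f t (i ∷ xs) ≡ suc (suc y) →
                NonzeroBetween f t xs (suc i) n → NonzeroBetween f t xs i n
    include-i probe-i nonzero j i≤j j<n with m≤n⇒m<n∨m≡n i≤j
    ... | inj₁ i<j = nonzero j i<j j<n
    ... | inj₂ refl = _ , probe-i

∅C : CE
∅C = muC oneC

∉∅C : ∀ x → ¬ x ∈W ∅C
∉∅C x (n , ev-mu s) with eval-deterministic (search-hit s) oneC-eval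
... | ()

ℕC : CE
ℕC = zeroC

∈ℕC : ∀ x → x ∈W ℕC
∈ℕC x = 0 , ev-zero

_∩C_ : CE → CE → CE
V ∩C W = compC (projC (# 0)) (V ∷ W ∷ [])

∈∩C : ∀ V W x → x ∈W (V ∩C W) ⇔ (x ∈W V × x ∈W W)
∈∩C V W x = mk⇔ (λ { (_ , ev-comp (p ∷ q ∷ []) _) → (_ , p) , (_ , q) })
                (λ { ((_ , p) , (_ , q)) → _ , ev-comp (p ∷ q ∷ []) ev-proj })

zerosC : Code 1 → CE
zerosC g = muC (compC g (projC (# 1) ∷ []))

∈zerosC : ∀ {g : Code 1} {v : ℕ → ℕ} →
          (∀ x → Eval g (x ∷ []) (v x)) → ∀ x → x ∈W zerosC g ⇔ v x ≡ 0
∈zerosC {g} {v} g-eval x =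
  mk⇔ zero-of (λ e → 0 , ev-mu (here (ev-comp (ev-proj ∷ []) (subst (Eval g (x ∷ [])) e (g-eval x)))))
  where
  zero-of : x ∈W zerosC g → v x ≡ 0
  zero-of (n , ev-mu s) with search-hit s
  ... | ev-comp (ev-proj ∷ []) e = eval-deterministic (g-eval x) e

-- Dovetailing: x ∈ V ∪ W is witnessed by a clock at which V or W has halted on x.
unionProbe : CE → CE → ℕ → ℕ → ℕ
unionProbe V W x t = sgᶜ (clocked V t (x ∷ [])) * sgᶜ (clocked W t (x ∷ []))

unionProbeC : CE → CE → Code 2
unionProbeC V W = compC mulC (compC sgᶜC (clockedC V ∷ []) ∷ compC sgᶜC (clockedC W ∷ []) ∷ [])

unionProbeC-eval : ∀ V W x t → Eval (unionProbeC V W) (t ∷ x ∷ []) (unionProbe V W x t)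
unionProbeC-eval V W x t = ev-comp (ev-comp (clockedC-eval V t (x ∷ []) ∷ []) (sgᶜC-eval _) ∷
                                    ev-comp (clockedC-eval W t (x ∷ []) ∷ []) (sgᶜC-eval _) ∷ [])
                                   (mulC-eval _ _)

_∪C_ : CE → CE → CE
V ∪C W = muC (unionProbeC V W)

∈∪C : ∀ V W x → x ∈W (V ∪C W) ⇔ (x ∈W V ⊎ x ∈W W)
∈∪C V W x = mk⇔ halted halts
  where
  sgᶜ≡0 : ∀ {a} → sgᶜ a ≡ 0 → a ≡ suc (pred a)
  sgᶜ≡0 {suc a} _ = refl

  halted : x ∈W (V ∪C W) → x ∈W V ⊎ x ∈W W
  halted (t , ev-mu s)
    with m*n≡0⇒m≡0∨n≡0 _ (eval-deterministic (unionProbeC-eval V W x t) (search-hit s))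
  ... | inj₁ e = inj₁ (_ , clocked-sound V t (x ∷ []) _ (sgᶜ≡0 e))
  ... | inj₂ e = inj₂ (_ , clocked-sound W t (x ∷ []) _ (sgᶜ≡0 e))

  probeAt : ∀ t → unionProbe V W x t ≡ 0 → x ∈W (V ∪C W)
  probeAt t e = let n , s = totalZero⇒search (unionProbeC-eval V W x) t e in n , ev-mu s

  halts : x ∈W V ⊎ x ∈W W → x ∈W (V ∪C W)
  halts (inj₁ (_ , p)) = let t , h = clocked-complete p in
    probeAt t (cong (λ a → sgᶜ a * sgᶜ (clocked W t (x ∷ []))) (h t ≤-refl))
  halts (inj₂ (_ , q)) = let t , h = clocked-complete q ; v = sgᶜ (clocked V t (x ∷ [])) in
    probeAt t (trans (cong (λ a → v * sgᶜ a) (h t ≤-refl)) (*-zeroʳ v))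

atLeastC : ℕ → CE
atLeastC b = zerosC (compC monusC (projC (# 0) ∷ constC b ∷ []))

∈atLeastC : ∀ b x → x ∈W atLeastC b ⇔ b ≤ x
∈atLeastC b x = mk⇔ (m∸n≡0⇒m≤n ∘ to ∈zeros) (from ∈zeros ∘ m≤n⇒m∸n≡0)
  where
  ∈zeros : x ∈W atLeastC b ⇔ b ∸ x ≡ 0
  ∈zeros = ∈zerosC (λ x → ev-comp (ev-proj ∷ constC-eval b ∷ []) (monusC-eval b x)) x

atMostC : ℕ → CE
atMostC a = zerosC (compC monusC (constC a ∷ projC (# 0) ∷ []))

∈atMostC : ∀ a x → x ∈W atMostC a ⇔ x ≤ a
∈atMostC a x = mk⇔ (m∸n≡0⇒m≤n ∘ to ∈zeros) (from ∈zeros ∘ m≤n⇒m∸n≡0)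
  where
  ∈zeros : x ∈W atMostC a ⇔ x ∸ a ≡ 0
  ∈zeros = ∈zerosC (λ x → ev-comp (constC-eval a ∷ ev-proj ∷ []) (monusC-eval x a)) x

singletonC : ℕ → CE
singletonC a = atLeastC a ∩C atMostC a

∈singletonC : ∀ a x → x ∈W singletonC a ⇔ x ≡ a
∈singletonC a x = mk⇔
  (λ p → let a≤x , x≤a = to (∈∩C _ _ x) p in
         ≤-antisym (to (∈atMostC a x) x≤a) (to (∈atLeastC a x) a≤x))
  (λ { refl → from (∈∩C _ _ x) (from (∈atLeastC a a) ≤-refl , from (∈atMostC a a) ≤-refl) })

finite-mono : ∀ {X Y : Pred} → X ⊆ Y → Finite Y → Finite X
finite-mono X⊆Y (b , f) = b , λ x p → f x (X⊆Y p)

finite-∪ : ∀ {X Y : Pred} → Finite X → Finite Y → Finite (X ∪ Y)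
finite-∪ (b₁ , f₁) (b₂ , f₂) =
  b₁ + b₂ , λ x → [ (λ p → <-≤-trans (f₁ x p) (m≤m+n b₁ b₂))
                   , (λ q → <-≤-trans (f₂ x q) (m≤n+m b₂ b₁)) ]

-- Bounds are decidable, so finiteness may be established by classical case analysis.
finite-¬¬ : ∀ {X Y : Pred} → (∀ {x} → X x → ¬ ¬ Y x) → Finite Y → Finite X
finite-¬¬ X⇒¬¬Y (b , f) = b , λ x p → decidable-stable (x <? b) (¬¬-map (f x) (X⇒¬¬Y p))

¬¬-cases : ∀ {P A : Set} → (P → A) → (¬ P → A) → ¬ ¬ A
¬¬-cases f g = ¬¬-map (λ { (yes p) → f p ; (no ¬p) → g ¬p }) ¬¬-excluded-middle

⊆⇒⊆* : ∀ {X Y : Pred} → X ⊆ Y → X ⊆* Y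
⊆⇒⊆* X⊆Y = 0 , λ x (p , ¬q) → ⊥-elim (¬q (X⊆Y p))

⊆*-refl : ∀ {X : Pred} → X ⊆* X
⊆*-refl = ⊆⇒⊆* (λ p → p)

⊆*-trans : ∀ {X Y Z : Pred} → X ⊆* Y → Y ⊆* Z → X ⊆* Z
⊆*-trans X⊆*Y Y⊆*Z =
  finite-¬¬ (λ (p , ¬r) → ¬¬-cases (λ q → inj₂ (q , ¬r)) (λ ¬q → inj₁ (p , ¬q))) (finite-∪ X⊆*Y Y⊆*Z)

⊆*-resp-=* : ∀ {X X′ Y Y′ : Pred} → X =* X′ → Y =* Y′ → X ⊆* Y → X′ ⊆* Y′
⊆*-resp-=* (_ , X′⊆*X) (Y⊆*Y′ , _) X⊆*Y = ⊆*-trans X′⊆*X (⊆*-trans X⊆*Y Y⊆*Y′)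

finite-⊆* : ∀ {X Y : Pred} → X ⊆* Y → Finite Y → Finite X
finite-⊆* X⊆*Y finY =
  finite-¬¬ (λ p → ¬¬-cases inj₂ (λ ¬q → inj₁ (p , ¬q))) (finite-∪ X⊆*Y finY)

⊆*-∩ : ∀ {X Y Z : Pred} → X ⊆* Y → X ⊆* Z → X ⊆* (Y ∩ Z)
⊆*-∩ X⊆*Y X⊆*Z =
  finite-¬¬ (λ (p , ¬qr) → ¬¬-cases (λ q → inj₂ (p , λ r → ¬qr (q , r))) (λ ¬q → inj₁ (p , ¬q)))
            (finite-∪ X⊆*Y X⊆*Z)

⊆*-∪ : ∀ {X Y Z : Pred} → X ⊆* Z → Y ⊆* Z → (X ∪ Y) ⊆* Z
⊆*-∪ X⊆*Z Y⊆*Z =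
  finite-mono (λ { (inj₁ p , ¬r) → inj₁ (p , ¬r) ; (inj₂ q , ¬r) → inj₂ (q , ¬r) }) (finite-∪ X⊆*Z Y⊆*Z)

⊆*-∁ : ∀ {X Y : Pred} → X ⊆* Y → ∁ Y ⊆* ∁ X
⊆*-∁ X⊆*Y = finite-¬¬ (λ (¬q , ¬¬p) → ¬¬-map (λ p → p , ¬q) ¬¬p) X⊆*Y

AlmostDisjoint : CE → CE → Set
AlmostDisjoint V A = Finite (⟦ V ⟧ ∩ ⟦ A ⟧)

¬'_ : ∀ {n} → Formula n → Formula n
¬' φ = φ ⇒ ⊥'

_∧'_ : ∀ {n} → Formula n → Formula n → Formula n
φ ∧' ψ = ¬' (φ ⇒ (¬' ψ))

∃' : ∀ {n} → Formula (suc n) → Formula n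
∃' φ = ¬' ∀' (¬' φ)

IsBottom IsTop : ∀ {n} → Fin n → Formula n
IsBottom i = ∀' (F.suc i ≤' F.zero)
IsTop i = ∀' (F.zero ≤' F.suc i)

MeetIsBottom JoinIsTop : ∀ {n} → Fin n → Fin n → Formula n
MeetIsBottom i j = ∀' ((F.zero ≤' F.suc i) ⇒ ((F.zero ≤' F.suc j) ⇒ IsBottom F.zero))
JoinIsTop i j = ∀' ((F.suc i ≤' F.zero) ⇒ ((F.suc j ≤' F.zero) ⇒ IsTop F.zero))

Complemented : ∀ {n} → Fin n → Formula n
Complemented i = ∃' (MeetIsBottom (F.suc i) F.zero ∧' JoinIsTop (F.suc i) F.zero)

-- A record rather than a definition, so that φ can be inferred from a proof of φ Expresses P.
record _Expresses_ {n} (φ : Formula n) (P : Env n → Set) : Set where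
  constructor expresses
  field sat⇔ : ∀ ρ → Sat φ ρ ⇔ P ρ

open _Expresses_

expresses-⇔ : ∀ {n} {φ : Formula n} {P Q} →
              φ Expresses P → (∀ ρ → P ρ ⇔ Q ρ) → φ Expresses Q
expresses-⇔ (expresses φ-P) P⇔Q = expresses λ ρ → P⇔Q ρ ⇔-∘ φ-P ρ

≤'-expresses : ∀ {n} (i j : Fin n) → (i ≤' j) Expresses (λ ρ → ⟦ ρ i ⟧ ⊆* ⟦ ρ j ⟧)
≤'-expresses i j = expresses λ ρ → ⇔-id _

⇒-expresses : ∀ {n} {φ ψ : Formula n} {P Q} →
              φ Expresses P → ψ Expresses Q → (φ ⇒ ψ) Expresses (λ ρ → P ρ → Q ρ)
⇒-expresses (expresses φ-P) (expresses ψ-Q) = expresses λ ρ → →-cong-⇔ (φ-P ρ) (ψ-Q ρ)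

∀'-expresses : ∀ {n} {φ : Formula (suc n)} {P} →
               φ Expresses P → ∀' φ Expresses (λ ρ → ∀ W → P (extend W ρ))
∀'-expresses (expresses φ-P) =
  expresses λ ρ → mk⇔ (λ s W → to (φ-P _) (s W)) (λ p W → from (φ-P _) (p W))

¬'-expresses : ∀ {n} {φ : Formula n} {P} → φ Expresses P → (¬' φ) Expresses (λ ρ → ¬ P ρ)
¬'-expresses (expresses φ-P) = expresses λ ρ → ¬-cong-⇔ (φ-P ρ)

IsBottom-expresses : ∀ {n} (i : Fin n) → IsBottom i Expresses (λ ρ → Finite ⟦ ρ i ⟧)
IsBottom-expresses i = expresses λ ρ →
  mk⇔ (λ below-all → finite-mono (λ p → p , ∉∅C _) (below-all ∅C)) (λ fin W → finite-mono proj₁ fin)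

IsTop-expresses : ∀ {n} (i : Fin n) → IsTop i Expresses (λ ρ → Finite (∁ ⟦ ρ i ⟧))
IsTop-expresses i = expresses λ ρ →
  mk⇔ (λ above-all → finite-mono (λ ¬p → ∈ℕC _ , ¬p) (above-all ℕC)) (λ fin W → finite-mono proj₂ fin)

MeetIsBottom-expresses : ∀ {n} (i j : Fin n) →
                         MeetIsBottom i j Expresses (λ ρ → AlmostDisjoint (ρ i) (ρ j))
MeetIsBottom-expresses i j = expresses λ ρ → mk⇔ (meet-finite ρ)
  (λ fin W W⊆*i W⊆*j → from (isBottom ρ W) (finite-⊆* (⊆*-∩ W⊆*i W⊆*j) fin))
  where
  isBottom : ∀ ρ W → Sat (IsBottom (# 0)) (extend W ρ) ⇔ Finite ⟦ W ⟧
  isBottom ρ W = sat⇔ (IsBottom-expresses (# 0)) (extend W ρ)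

  meet-finite : ∀ ρ → Sat (MeetIsBottom i j) ρ → AlmostDisjoint (ρ i) (ρ j)
  meet-finite ρ meet = finite-mono (from (∈∩C (ρ i) (ρ j) _)) (to (isBottom ρ (ρ i ∩C ρ j))
    (meet (ρ i ∩C ρ j) (⊆⇒⊆* (proj₁ ∘ to (∈∩C (ρ i) (ρ j) _)))
                       (⊆⇒⊆* (proj₂ ∘ to (∈∩C (ρ i) (ρ j) _)))))

JoinIsTop-expresses : ∀ {n} (i j : Fin n) →
                      JoinIsTop i j Expresses (λ ρ → Finite (∁ ⟦ ρ i ⟧ ∩ ∁ ⟦ ρ j ⟧))
JoinIsTop-expresses i j = expresses λ ρ → mk⇔ (outside-join-finite ρ)
  (λ fin W i⊆*W j⊆*W → from (isTop ρ W)
    (finite-⊆* (⊆*-trans (⊆*-∁ (⊆*-∪ i⊆*W j⊆*W)) (⊆⇒⊆* (λ ¬pq → ¬pq ∘ inj₁ , ¬pq ∘ inj₂))) fin))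
  where
  isTop : ∀ ρ W → Sat (IsTop (# 0)) (extend W ρ) ⇔ Finite (∁ ⟦ W ⟧)
  isTop ρ W = sat⇔ (IsTop-expresses (# 0)) (extend W ρ)

  outside-join-finite : ∀ ρ → Sat (JoinIsTop i j) ρ → Finite (∁ ⟦ ρ i ⟧ ∩ ∁ ⟦ ρ j ⟧)
  outside-join-finite ρ join =
    finite-mono (λ (¬p , ¬q) → [ ¬p , ¬q ] ∘ to (∈∪C (ρ i) (ρ j) _)) (to (isTop ρ (ρ i ∪C ρ j))
      (join (ρ i ∪C ρ j) (⊆⇒⊆* (from (∈∪C (ρ i) (ρ j) _) ∘ inj₁))
                         (⊆⇒⊆* (from (∈∪C (ρ i) (ρ j) _) ∘ inj₂))))

_≈*_ : ∀ {n} → Env n → Env n → Set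
ρ ≈* ρ′ = ∀ i → ⟦ ρ i ⟧ =* ⟦ ρ′ i ⟧

≈*-sym : ∀ {n} {ρ ρ′ : Env n} → ρ ≈* ρ′ → ρ′ ≈* ρ
≈*-sym ρ≈*ρ′ i = proj₂ (ρ≈*ρ′ i) , proj₁ (ρ≈*ρ′ i)

extend-≈* : ∀ {n} {ρ ρ′ : Env n} W → ρ ≈* ρ′ → extend W ρ ≈* extend W ρ′
extend-≈* W ρ≈*ρ′ F.zero = ⊆*-refl , ⊆*-refl
extend-≈* W ρ≈*ρ′ (F.suc i) = ρ≈*ρ′ i

sat-≈* : ∀ {n} (φ : Formula n) {ρ ρ′ : Env n} → ρ ≈* ρ′ → Sat φ ρ → Sat φ ρ′
sat-≈* (i ≤' j) ρ≈*ρ′ i≤j = ⊆*-resp-=* (ρ≈*ρ′ i) (ρ≈*ρ′ j) i≤j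
sat-≈* (i ≐ j) ρ≈*ρ′ (i≤j , j≤i) =
  ⊆*-resp-=* (ρ≈*ρ′ i) (ρ≈*ρ′ j) i≤j , ⊆*-resp-=* (ρ≈*ρ′ j) (ρ≈*ρ′ i) j≤i
sat-≈* ⊥' ρ≈*ρ′ ()
sat-≈* (φ ⇒ ψ) ρ≈*ρ′ φ⇒ψ = sat-≈* ψ ρ≈*ρ′ ∘ φ⇒ψ ∘ sat-≈* φ (≈*-sym ρ≈*ρ′)
sat-≈* (∀' φ) ρ≈*ρ′ ∀φ W = sat-≈* φ (extend-≈* W ρ≈*ρ′) (∀φ W)

Invariant : (CE → Set) → Set
Invariant P = ∀ {V V′} → ⟦ V ⟧ =* ⟦ V′ ⟧ → P V → P V′

finite-invariant : Invariant (Finite ∘ ⟦_⟧)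
finite-invariant (_ , V′⊆*V) = finite-⊆* V′⊆*V

infinite-invariant : Invariant Infinite
infinite-invariant (V⊆*V′ , _) infV finV′ = infV (finite-⊆* V⊆*V′ finV′)

⊆*-invariant : ∀ R → Invariant (λ V → ⟦ V ⟧ ⊆* ⟦ R ⟧)
⊆*-invariant R (_ , V′⊆*V) V⊆*R = ⊆*-trans V′⊆*V V⊆*R

disjoint⇒almostDisjoint : ∀ {V A} → Disjoint V A → AlmostDisjoint V A
disjoint⇒almostDisjoint V∩A≡∅ = 0 , λ x (p , a) → ⊥-elim (V∩A≡∅ x p a)

disjoint-variant : ∀ {V A} → AlmostDisjoint V A → Σ CE λ V′ → ⟦ V′ ⟧ =* ⟦ V ⟧ × Disjoint V′ A
disjoint-variant {V} {A} (b , below) =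
  V ∩C atLeastC b , (⊆⇒⊆* (proj₁ ∘ to (∈∩C _ _ _)) , V⊆*V′) , disjoint
  where
  V⊆*V′ : ⟦ V ⟧ ⊆* ⟦ V ∩C atLeastC b ⟧
  V⊆*V′ = b , λ x (p , ∉V′) → ≰⇒> (λ b≤x → ∉V′ (from (∈∩C _ _ x) (p , from (∈atLeastC b x) b≤x)))

  disjoint : Disjoint (V ∩C atLeastC b) A
  disjoint x p a = let v , b≤x = to (∈∩C _ _ x) p in <⇒≱ (below x (v , a)) (to (∈atLeastC b x) b≤x)

∀disjoint⇔∀almostDisjoint : ∀ {P A} → Invariant P →
                            (∀ V → Disjoint V A → P V) ⇔ (∀ V → AlmostDisjoint V A → P V)
∀disjoint⇔∀almostDisjoint P-inv = mk⇔
  (λ onDisjoint V ad → let V′ , V′=*V , d = disjoint-variant ad in P-inv V′=*V (onDisjoint V′ d))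
  (λ onAlmost V d → onAlmost V (disjoint⇒almostDisjoint d))

union-empty : ∀ {Ws} → All IsEmpty Ws → ∀ x → ¬ Union Ws x
union-empty (W≡∅ ∷ _) x (here p) = W≡∅ x p
union-empty (_ ∷ Ws≡∅) x (there u) = union-empty Ws≡∅ x u

union-same : ∀ {Ws R} → All (Singleton R) Ws → Union Ws ⊆ ⟦ R ⟧
union-same (W≡R ∷ _) (here p) = to (W≡R _) p
union-same (_ ∷ Ws≡R) (there u) = union-same Ws≡R u

generatesEmpty⇔ : ∀ A → Generates SingletonEmpty A ⇔ (∀ V → Disjoint V A → Finite ⟦ V ⟧)
generatesEmpty⇔ A = mk⇔ disjoint-finite
  (λ finite → (λ W W≡∅ x w _ → W≡∅ x w) , λ V d → [] , [] , finite-mono proj₁ (finite V d))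
  where
  disjoint-finite : Generates SingletonEmpty A → ∀ V → Disjoint V A → Finite ⟦ V ⟧
  disjoint-finite (_ , cover) V d with cover V d
  ... | _ , Ws≡∅ , V⊆*Ws = finite-⊆* V⊆*Ws (0 , λ x u → ⊥-elim (union-empty Ws≡∅ x u))

generatesSingleton⇔ : ∀ R A →
                      Generates (Singleton R) A ⇔ (Disjoint R A × (∀ V → Disjoint V A → ⟦ V ⟧ ⊆* ⟦ R ⟧))
generatesSingleton⇔ R A = mk⇔
  (λ gen → proj₁ gen R (λ _ → ⇔-id _) , disjoint-below gen)
  (λ (R∩A≡∅ , below) → (λ W W≡R x w → R∩A≡∅ x (to (W≡R x) w)) ,
                       λ V d → R ∷ [] , (λ _ → ⇔-id _) ∷ [] , ⊆*-trans (below V d) (⊆⇒⊆* here))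
  where
  disjoint-below : Generates (Singleton R) A → ∀ V → Disjoint V A → ⟦ V ⟧ ⊆* ⟦ R ⟧
  disjoint-below (_ , cover) V d with cover V d
  ... | _ , Ws≡R , V⊆*Ws = ⊆*-trans V⊆*Ws (⊆⇒⊆* (union-same Ws≡R))

¬-invariant : ∀ {P} → Invariant P → Invariant (λ V → ¬ P V)
¬-invariant P-inv (V⊆*V′ , V′⊆*V) ¬pV pV′ = ¬pV (P-inv (V′⊆*V , V⊆*V′) pV′)

HasPrincipalGenerator : (CE → Set) → CE → Set
HasPrincipalGenerator Q A = Σ CE λ R → Infinite R × Q R × Generates (Singleton R) A

AlmostGenerates : CE → CE → Set
AlmostGenerates R A = AlmostDisjoint R A × (∀ V → AlmostDisjoint V A → ⟦ V ⟧ ⊆* ⟦ R ⟧)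

hasType1Gen⇔ : ∀ A → HasType1Gen A ⇔ (∀ V → AlmostDisjoint V A → Finite ⟦ V ⟧)
hasType1Gen⇔ A = ∀disjoint⇔∀almostDisjoint finite-invariant ⇔-∘ generatesEmpty⇔ A

hasPrincipalGenerator⇔ : ∀ {Q} → Invariant Q → ∀ A →
                         HasPrincipalGenerator Q A ⇔ (Σ CE λ R → AlmostGenerates R A × Infinite R × Q R)
hasPrincipalGenerator⇔ {Q} Q-inv A = mk⇔ almost exact
  where
  almost : HasPrincipalGenerator Q A → Σ CE λ R → AlmostGenerates R A × Infinite R × Q R
  almost (R , infR , qR , gen) =
    let R∩A≡∅ , below = to (generatesSingleton⇔ R A) gen in
    R , (disjoint⇒almostDisjoint R∩A≡∅ , to (∀disjoint⇔∀almostDisjoint (⊆*-invariant R)) below) ,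
    infR , qR

  exact : (Σ CE λ R → AlmostGenerates R A × Infinite R × Q R) → HasPrincipalGenerator Q A
  exact (R , (adR , below) , infR , qR) =
    let R′ , (R′⊆*R , R⊆*R′) , R′∩A≡∅ = disjoint-variant adR in
    R′ , infinite-invariant (R⊆*R′ , R′⊆*R) infR , Q-inv (R⊆*R′ , R′⊆*R) qR ,
    from (generatesSingleton⇔ R′ A) (R′∩A≡∅ , λ V d → ⊆*-trans (below V (disjoint⇒almostDisjoint d)) R⊆*R′)

Type1 : Formula 1
Type1 = ∀' (MeetIsBottom (# 0) (# 1) ⇒ IsBottom (# 0))

Type1-expresses : Type1 Expresses (λ ρ → HasType1Gen (ρ (# 0)))
Type1-expresses =
  expresses-⇔ (∀'-expresses (⇒-expresses (MeetIsBottom-expresses (# 0) (# 1)) (IsBottom-expresses (# 0))))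
              (λ ρ → ⇔-sym (hasType1Gen⇔ (ρ (# 0))))

-- Variable 0 of Generator is the generator R, variable 1 the set A.
Generator : Formula 2
Generator = MeetIsBottom (# 0) (# 1) ∧' ∀' (MeetIsBottom (# 0) (# 2) ⇒ ((# 0) ≤' (# 1)))

Principal : Formula 2 → Formula 1
Principal q = ∃' (Generator ∧' ((¬' IsBottom (# 0)) ∧' q))

module Classical (lem : ExcludedMiddle 0ℓ) where

  stable : ∀ {P : Set} → ¬ ¬ P → P
  stable = decidable-stable lem

  ∧'-expresses : ∀ {n} {φ ψ : Formula n} {P Q} →
                 φ Expresses P → ψ Expresses Q → (φ ∧' ψ) Expresses (λ ρ → P ρ × Q ρ)
  ∧'-expresses (expresses φ-P) (expresses ψ-Q) = expresses λ ρ → mk⇔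
    (λ ¬[φ⇒¬ψ] → to (φ-P ρ) (stable λ ¬φ → ¬[φ⇒¬ψ] λ φ _ → ¬φ φ) ,
                 to (ψ-Q ρ) (stable λ ¬ψ → ¬[φ⇒¬ψ] λ _ ψ → ¬ψ ψ))
    (λ (p , q) φ⇒¬ψ → φ⇒¬ψ (from (φ-P ρ) p) (from (ψ-Q ρ) q))

  ∃'-expresses : ∀ {n} {φ : Formula (suc n)} {P} →
                 φ Expresses P → ∃' φ Expresses (λ ρ → Σ CE λ W → P (extend W ρ))
  ∃'-expresses (expresses φ-P) = expresses λ ρ → mk⇔
    (λ ¬∀¬φ → stable λ ¬∃ → ¬∀¬φ λ W φ → ¬∃ (W , to (φ-P _) φ))
    (λ (W , p) ∀¬φ → ∀¬φ W (from (φ-P _) p))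

  finite⇒ce : ∀ {S : Pred} b → (∀ x → S x → x < b) → Σ CE λ F → ∀ x → x ∈W F ⇔ S x
  finite⇒ce zero below = ∅C , λ x → mk⇔ (⊥-elim ∘ ∉∅C x) (λ s → ⊥-elim (n≮0 (below x s)))
  finite⇒ce {S} (suc b) below with finite⇒ce {S ∩ (_< b)} b (λ _ → proj₂) | lem {S b}
  ... | F , ∈F | yes s-b = F ∪C singletonC b , λ x → mk⇔ (in-S x) (in-F∪b x)
    where
    in-S : ∀ x → x ∈W (F ∪C singletonC b) → S x
    in-S x u with to (∈∪C F (singletonC b) x) u
    ... | inj₁ p = proj₁ (to (∈F x) p)
    ... | inj₂ q with to (∈singletonC b x) q
    ... | refl = s-b

    in-F∪b : ∀ x → S x → x ∈W (F ∪C singletonC b)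
    in-F∪b x s with m<1+n⇒m<n∨m≡n (below x s)
    ... | inj₁ x<b = from (∈∪C F (singletonC b) x) (inj₁ (from (∈F x) (s , x<b)))
    ... | inj₂ refl = from (∈∪C F (singletonC b) x) (inj₂ (from (∈singletonC x x) refl))
  ... | F , ∈F | no ¬s-b = F , λ x → mk⇔ (proj₁ ∘ to (∈F x)) (λ s → from (∈F x) (s , below-b x s))
    where
    below-b : ∀ x → S x → x < b
    below-b x s with m<1+n⇒m<n∨m≡n (below x s)
    ... | inj₁ x<b = x<b
    ... | inj₂ refl = ⊥-elim (¬s-b s)

  AlmostComplemented : CE → Set
  AlmostComplemented X = Σ CE λ Y → AlmostDisjoint X Y × Finite (∁ ⟦ X ⟧ ∩ ∁ ⟦ Y ⟧)

  computable⇔almostComplemented : ∀ X → Computable X ⇔ AlmostComplemented X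
  computable⇔almostComplemented X = mk⇔
    (λ (V , V≡∁X) → V , (0 , λ x (p , q) → ⊥-elim (to (V≡∁X x) q p))
                      , (0 , λ x (¬p , ¬q) → ⊥-elim (¬q (from (V≡∁X x) ¬p))))
    patch
    where
    -- From b on, Y coincides with the complement of X; below b that complement is a finite set.
    patch : AlmostComplemented X → Computable X
    patch (Y , (b₁ , X∩Y-below) , (b₂ , outside-below)) = V , λ x → mk⇔ (∉X x) (∈V x)
      where
      b : ℕ
      b = b₁ + b₂

      outsideBelow-b : Σ CE λ F → ∀ x → x ∈W F ⇔ (x < b × ¬ x ∈W X)
      outsideBelow-b = finite⇒ce b (λ _ → proj₁)

      F V : CE
      F = proj₁ outsideBelow-b
      V = (Y ∩C atLeastC b) ∪C F

      ∉X : ∀ x → x ∈W V → ¬ x ∈W X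
      ∉X x v with to (∈∪C (Y ∩C atLeastC b) F x) v
      ... | inj₁ q = let y , b≤x = to (∈∩C Y (atLeastC b) x) q in
                     λ p → <⇒≱ (X∩Y-below x (p , y)) (m+n≤o⇒m≤o b₁ (to (∈atLeastC b x) b≤x))
      ... | inj₂ q = proj₂ (to (proj₂ outsideBelow-b x) q)

      ∈V : ∀ x → ¬ x ∈W X → x ∈W V
      ∈V x ¬p with x <? b | lem {x ∈W Y}
      ... | yes x<b | _ =
        from (∈∪C (Y ∩C atLeastC b) F x) (inj₂ (from (proj₂ outsideBelow-b x) (x<b , ¬p)))
      ... | no x≮b | yes y =
        from (∈∪C (Y ∩C atLeastC b) F x)
             (inj₁ (from (∈∩C Y (atLeastC b) x) (y , from (∈atLeastC b x) (≮⇒≥ x≮b))))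
      ... | no x≮b | no ¬y = ⊥-elim (<⇒≱ (outside-below x (¬p , ¬y)) (m+n≤o⇒n≤o b₁ (≮⇒≥ x≮b)))

  Complemented-expresses : ∀ {n} (i : Fin n) → Complemented i Expresses (λ ρ → Computable (ρ i))
  Complemented-expresses i =
    expresses-⇔ (∃'-expresses (∧'-expresses (MeetIsBottom-expresses (F.suc i) (# 0))
                                            (JoinIsTop-expresses (F.suc i) (# 0))))
                (λ ρ → ⇔-sym (computable⇔almostComplemented (ρ i)))

  -- Computability is expressed by a formula of 𝓔*, hence invariant under finite variants.
  computable-invariant : Invariant Computable
  computable-invariant {V} {V′} V=*V′ =
    to (sat⇔ (Complemented-expresses {1} (# 0)) (λ _ → V′)) ∘
    sat-≈* (Complemented {1} (# 0)) {λ _ → V} {λ _ → V′} (λ _ → V=*V′) ∘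
    from (sat⇔ (Complemented-expresses {1} (# 0)) (λ _ → V))

  Generator-expresses : Generator Expresses (λ ρ → AlmostGenerates (ρ (# 0)) (ρ (# 1)))
  Generator-expresses =
    ∧'-expresses (MeetIsBottom-expresses (# 0) (# 1))
                 (∀'-expresses (⇒-expresses (MeetIsBottom-expresses (# 0) (# 2)) (≤'-expresses (# 0) (# 1))))

  Principal-expresses : ∀ {q Q} → Invariant Q → q Expresses (λ ρ → Q (ρ (# 0))) →
                        Principal q Expresses (λ ρ → HasPrincipalGenerator Q (ρ (# 0)))
  Principal-expresses Q-inv q-Q =
    expresses-⇔ (∃'-expresses (∧'-expresses Generator-expresses
                                            (∧'-expresses (¬'-expresses (IsBottom-expresses (# 0))) q-Q)))
                (λ ρ → ⇔-sym (hasPrincipalGenerator⇔ Q-inv (ρ (# 0))))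

  HasType2Gen-expresses : Principal (Complemented (# 0)) Expresses (λ ρ → HasType2Gen (ρ (# 0)))
  HasType2Gen-expresses = Principal-expresses computable-invariant (Complemented-expresses (# 0))

  HasType3Gen-expresses : Principal (¬' Complemented (# 0)) Expresses (λ ρ → HasType3Gen (ρ (# 0)))
  HasType3Gen-expresses =
    Principal-expresses (¬-invariant computable-invariant) (¬'-expresses (Complemented-expresses (# 0)))

definable : ∀ {φ : Formula 1} {P} → φ Expresses (λ ρ → P (ρ (# 0))) → Definable P
definable {φ} φ-P = φ , λ A → sat⇔ φ-P (λ _ → A)

lemma3p17 : ExcludedMiddle 0ℓ → (n : ℕ) → 1 ≤ n → n ≤ 3 → Definable (IsType n)
lemma3p17 _ 0 () _
lemma3p17 _ 1 _ _ = definable Type1-expresses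
lemma3p17 lem 2 _ _ = definable (∧'-expresses HasType2Gen-expresses (¬'-expresses Type1-expresses))
  where open Classical lem
lemma3p17 lem 3 _ _ =
  definable (∧'-expresses HasType3Gen-expresses
                          (∧'-expresses (¬'-expresses Type1-expresses) (¬'-expresses HasType2Gen-expresses)))
  where open Classical lem
lemma3p17 _ (suc (suc (suc (suc _)))) _ (s≤s (s≤s (s≤s ())))
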